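{- Let $G$ be a group and $\mathcal S$ a set of 3-element subsets of $G$ satisfying conditions (0), (A), (B), (C), (D) below. If $g\ne g'\in G$ and $\tau,\tau'\in\mathcal T$ satisfy $e(g,\tau)=e(g',\tau')$, then writing $\tau=\{t_1,t_2\}$ we have $t_1t_2=t_2t_1$, $g'=t_1t_2g$ and $\tau'=\{t_1^{ -1},t_2^{ -1}\}$.
   Context: Types: $\mathcal T$ is the set of 2-element subsets $\{a,b\}\subset G$ contained in some member of $\mathcal S$; $\mathcal T_o$ is the set of ordered pairs $(a,b)$ with $\{a,b\}\in\mathcal T$, and $(a,b)^{ -1}:=(b^{ -1},a^{ -1})$. For $g\in G$, $\tau=\{a,b\}\in\mathcal T$, $e(g,\tau):=\{ag,bg\}$. $L$ is the graph on $\mathcal T$ with $\tau\sim\tau'$ iff $\tau\ne\tau'$ and some member of $\mathcal S$ contains $\tau\cup\tau'$. Conditions: (0) no $\tau\in\mathcal T$ has the form $\{s,s^{ -1}\}$; (A) if $t\in\mathcal T_o$ then $t^{ -1}\in\mathcal T_o$; (B) for $t\neq t'$ in $\mathcal T_o$, $t_1t_2^{ -1}=t'_1(t'_2)^{ -1}$ implies $t'_2=t_1^{ -1}$ and $t'_1=t_2^{ -1}$; (C) every $\tau\in\mathcal T$ is contained in exactly $\tilde d$ members of $\mathcal S$; (D) $L$ is connected. -}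

module Defs where

open import Level using (0ℓ)
open import Data.Nat using (ℕ)
open import Data.Fin using (Fin)
open import Data.Product using (Σ; ∃; _×_; _,_)
open import Data.Sum using (_⊎_)
open import Relation.Nullary using (¬_)
open import Relation.Binary.PropositionalEquality using (_≡_; _≢_)
open import Relation.Binary.Construct.Closure.ReflexiveTransitive using (Star)
open import Function.Bundles using (_↔_)
open import Algebra.Structures using (IsGroup)

-- A group (G, _∙_, ε, _⁻¹) with propositional equality as its equality.
-- A set 𝒮 of 3-element subsets of G is encoded as a ternary relation:
-- 𝒮 x y z  means  {x,y,z} ∈ 𝒮.
module Setup {G : Set} (_∙_ : G → G → G) (ε : G) (_⁻¹ : G → G)
             (𝒮 : G → G → G → Set) where

  _∈₃_ : G → G × G × G → Set
  a ∈₃ (x , y , z) = (a ≡ x) ⊎ (a ≡ y) ⊎ (a ≡ z)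

  record IsSetOf3Subsets : Set where
    field
      distinct₁₂ : ∀ {x y z} → 𝒮 x y z → x ≢ y
      distinct₁₃ : ∀ {x y z} → 𝒮 x y z → x ≢ z
      distinct₂₃ : ∀ {x y z} → 𝒮 x y z → y ≢ z
      swap₁₂     : ∀ {x y z} → 𝒮 x y z → 𝒮 y x z
      rotate     : ∀ {x y z} → 𝒮 x y z → 𝒮 y z x
      irrelevant : ∀ {x y z} (p q : 𝒮 x y z) → p ≡ q

  -- {a,b} ∈ 𝒯 : a 2-element subset contained in some member of 𝒮
  InT : G → G → Set
  InT a b = (a ≢ b) × (Σ (G × G × G) λ m → (let (x , y , z) = m in 𝒮 x y z)
                                   × (a ∈₃ m) × (b ∈₃ m))

  InTo : G × G → Set
  InTo (a , b) = InT a b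

  pinv : G × G → G × G
  pinv (a , b) = (b ⁻¹ , a ⁻¹)

  SameSet : G × G → G × G → Set
  SameSet (a , b) (c , d) = ((a ≡ c) × (b ≡ d)) ⊎ ((a ≡ d) × (b ≡ c))

  -- e(g, {a,b}) := {ag, bg}, as an ordered representative
  e : G → G × G → G × G
  e g (a , b) = (a ∙ g , b ∙ g)

  Adj : G × G → G × G → Set
  Adj (a , b) (c , d) =
    InT a b × InT c d × ¬ SameSet (a , b) (c , d) ×
    (Σ (G × G × G) λ m → (let (x , y , z) = m in 𝒮 x y z)
       × (a ∈₃ m) × (b ∈₃ m) × (c ∈₃ m) × (d ∈₃ m))

  -- a step of a walk in L, allowing also to change the representative of
  -- the current vertex
  Step : G × G → G × G → Set
  Step p q = SameSet p q ⊎ Adj p q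

  Cond0 : Set
  Cond0 = ∀ a b → InT a b → b ≢ a ⁻¹

  CondA : Set
  CondA = ∀ t → InTo t → InTo (pinv t)

  CondB : Set
  CondB = ∀ t t' → InTo t → InTo t' → t ≢ t' →
    (let (t₁ , t₂) = t ; (t₁' , t₂') = t' in
      t₁ ∙ (t₂ ⁻¹) ≡ t₁' ∙ (t₂' ⁻¹) → (t₂' ≡ t₁ ⁻¹) × (t₁' ≡ t₂ ⁻¹))

  -- (C): the members of 𝒮 containing {a,b} are exactly the sets {a,b,c}
  -- with 𝒮 a b c, so they correspond bijectively to such c.
  CondC : ℕ → Set
  CondC d̃ = ∀ a b → InT a b → (Σ G λ c → 𝒮 a b c) ↔ Fin d̃

  CondD : Set
  CondD = ∀ τ τ' → InTo τ → InTo τ' → Star Step τ τ'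

-- Comparing the two translates coordinatewise, the right quotient a b⁻¹ of
-- τ = (a , b) equals that of τ' = (c , d), since right translation by g or g'
-- cancels out of it; and τ ≠ τ' because g ≠ g'. Condition (B) then forces
-- τ' = (b⁻¹ , a⁻¹). Solving a g = b⁻¹ g' and b g = a⁻¹ g' for g' gives
-- g' = b a g = a b g, whence a and b commute.
module Submission where

open import Defs
open import Data.Nat using (ℕ)
open import Data.Product using (_×_; _,_; proj₁; proj₂)
open import Data.Sum using (inj₁; inj₂)
open import Relation.Binary.PropositionalEquality
  using (_≡_; _≢_; refl; sym; trans; cong; cong₂; module ≡-Reasoning)
open import Algebra.Bundles using (Group)
open import Algebra.Structures using (IsGroup)
import Algebra.Properties.Group as GroupProperties
import Relation.Binary.Reasoning.Setoid as SetoidReasoning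

module _ {c ℓ} (𝔾 : Group c ℓ) where
  open Group 𝔾
  open GroupProperties 𝔾 using (⁻¹-anti-homo-∙; \\-leftDividesˡ)
  open SetoidReasoning setoid

  x∙z//y∙z≈x//y : ∀ x y z → (x ∙ z) // (y ∙ z) ≈ x // y
  x∙z//y∙z≈x//y x y z = begin
    (x ∙ z) ∙ (y ∙ z) ⁻¹      ≈⟨ ∙-congˡ (⁻¹-anti-homo-∙ y z) ⟩
    (x ∙ z) ∙ (z ⁻¹ ∙ y ⁻¹)   ≈⟨ assoc x z (z ⁻¹ ∙ y ⁻¹) ⟩
    x ∙ (z ∙ (z ⁻¹ ∙ y ⁻¹))   ≈⟨ ∙-congˡ (\\-leftDividesˡ z (y ⁻¹)) ⟩
    x ∙ y ⁻¹                  ∎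

  y≈x⁻¹∙z⇒z≈x∙y : ∀ {x y z} → y ≈ x ⁻¹ ∙ z → z ≈ x ∙ y
  y≈x⁻¹∙z⇒z≈x∙y {x} {y} {z} y≈x⁻¹∙z = begin
    z               ≈⟨ \\-leftDividesˡ x z ⟨
    x ∙ (x ⁻¹ ∙ z)  ≈⟨ ∙-congˡ y≈x⁻¹∙z ⟨
    x ∙ y           ∎

module TranslateCollision {G : Set} {mul : G → G → G} {unit : G} {inv : G → G}
                          (isGroup : IsGroup _≡_ mul unit inv)
                          (𝒮 : G → G → G → Set) where

  group : Group _ _
  group = record { isGroup = isGroup }

  open Group group using (_∙_; _⁻¹; _//_; assoc)
  open GroupProperties group using (∙-cancelˡ; ∙-cancelʳ)
  open Setup mul unit inv 𝒮

  InT-sym : ∀ {a b} → InT a b → InT b a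
  InT-sym (a≢b , m , m∈𝒮 , a∈m , b∈m) = (λ b≡a → a≢b (sym b≡a)) , m , m∈𝒮 , b∈m , a∈m

  ordered-collision : CondB → ∀ {g g' a b c d} → g ≢ g' → InT a b → InT c d →
    a ∙ g ≡ c ∙ g' → b ∙ g ≡ d ∙ g' →
    (a ∙ b ≡ b ∙ a) × (g' ≡ (a ∙ b) ∙ g) × (c ≡ b ⁻¹) × (d ≡ a ⁻¹)
  ordered-collision condB {g} {g'} {a} {b} {c} {d} g≢g' ab∈𝒯 cd∈𝒯 ag≡cg' bg≡dg' =
    ab≡ba , g'≡abg , c≡b⁻¹ , d≡a⁻¹
    where
      ab≢cd : (a , b) ≢ (c , d)
      ab≢cd refl = g≢g' (∙-cancelˡ a g g' ag≡cg')

      same-quotient : a // b ≡ c // d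
      same-quotient = begin
        a // b               ≡⟨ x∙z//y∙z≈x//y group a b g ⟨
        (a ∙ g) // (b ∙ g)   ≡⟨ cong₂ _//_ ag≡cg' bg≡dg' ⟩
        (c ∙ g') // (d ∙ g') ≡⟨ x∙z//y∙z≈x//y group c d g' ⟩
        c // d               ∎
        where open ≡-Reasoning

      inverse-swap : (d ≡ a ⁻¹) × (c ≡ b ⁻¹)
      inverse-swap = condB (a , b) (c , d) ab∈𝒯 cd∈𝒯 ab≢cd same-quotient

      d≡a⁻¹ : d ≡ a ⁻¹
      d≡a⁻¹ = proj₁ inverse-swap

      c≡b⁻¹ : c ≡ b ⁻¹
      c≡b⁻¹ = proj₂ inverse-swap

      g'≡abg : g' ≡ (a ∙ b) ∙ g
      g'≡abg = trans (y≈x⁻¹∙z⇒z≈x∙y group (trans bg≡dg' (cong (_∙ g') d≡a⁻¹)))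
                     (sym (assoc a b g))

      g'≡bag : g' ≡ (b ∙ a) ∙ g
      g'≡bag = trans (y≈x⁻¹∙z⇒z≈x∙y group (trans ag≡cg' (cong (_∙ g') c≡b⁻¹)))
                     (sym (assoc b a g))

      ab≡ba : a ∙ b ≡ b ∙ a
      ab≡ba = ∙-cancelʳ g (a ∙ b) (b ∙ a) (trans (sym g'≡abg) g'≡bag)

  collision : CondB → ∀ {g g' t₁ t₂ u₁ u₂} → g ≢ g' → InT t₁ t₂ → InT u₁ u₂ →
    SameSet (e g (t₁ , t₂)) (e g' (u₁ , u₂)) →
    (t₁ ∙ t₂ ≡ t₂ ∙ t₁) × (g' ≡ (t₁ ∙ t₂) ∙ g) × SameSet (u₁ , u₂) (t₁ ⁻¹ , t₂ ⁻¹)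
  collision condB g≢g' t∈𝒯 u∈𝒯 (inj₁ (p , q))
    with ordered-collision condB g≢g' t∈𝒯 u∈𝒯 p q
  ... | comm , g'≡ , u₁≡t₂⁻¹ , u₂≡t₁⁻¹ = comm , g'≡ , inj₂ (u₁≡t₂⁻¹ , u₂≡t₁⁻¹)
  collision condB g≢g' t∈𝒯 u∈𝒯 (inj₂ (p , q))
    with ordered-collision condB g≢g' t∈𝒯 (InT-sym u∈𝒯) p q
  ... | comm , g'≡ , u₂≡t₂⁻¹ , u₁≡t₁⁻¹ = comm , g'≡ , inj₁ (u₁≡t₁⁻¹ , u₂≡t₂⁻¹)

-- Only condition (B) is needed.
mainTheorem4 : {G : Set} (_∙_ : G → G → G) (ε : G) (_⁻¹ : G → G)
    → IsGroup _≡_ _∙_ ε _⁻¹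
    → (𝒮 : G → G → G → Set) (d̃ : ℕ)
    → Setup.IsSetOf3Subsets _∙_ ε _⁻¹ 𝒮
    → Setup.Cond0 _∙_ ε _⁻¹ 𝒮
    → Setup.CondA _∙_ ε _⁻¹ 𝒮
    → Setup.CondB _∙_ ε _⁻¹ 𝒮
    → Setup.CondC _∙_ ε _⁻¹ 𝒮 d̃
    → Setup.CondD _∙_ ε _⁻¹ 𝒮
    → (g g' t₁ t₂ u₁ u₂ : G) → g ≢ g'
    → Setup.InT _∙_ ε _⁻¹ 𝒮 t₁ t₂
    → Setup.InT _∙_ ε _⁻¹ 𝒮 u₁ u₂
    → Setup.SameSet _∙_ ε _⁻¹ 𝒮 (Setup.e _∙_ ε _⁻¹ 𝒮 g (t₁ , t₂)) (Setup.e _∙_ ε _⁻¹ 𝒮 g' (u₁ , u₂))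
    → (t₁ ∙ t₂ ≡ t₂ ∙ t₁) × (g' ≡ (t₁ ∙ t₂) ∙ g) × Setup.SameSet _∙_ ε _⁻¹ 𝒮 (u₁ , u₂) (t₁ ⁻¹ , t₂ ⁻¹)
mainTheorem4 _ _ _ isGroup 𝒮 _ _ _ _ condB _ _ _ _ _ _ _ _ g≢g' t∈𝒯 u∈𝒯 translates-equal =
  TranslateCollision.collision isGroup 𝒮 condB g≢g' t∈𝒯 u∈𝒯 translates-equal
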